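{- For $n\geqslant1$ and real $q\geqslant0$ let $B_n(x,q)=\sum_{\sigma\in\mathcal{S}^B_n}x^{\mathrm{des}_B(\sigma)}q^{\mathrm{neg}(\sigma)}=\sum_{k=0}^nB_{n,k}(q)x^k$. If $q\geqslant1$, then $B_n(x,q)$ is alternatingly increasing: $B_{n,0}(q)\leqslant B_{n,n}(q)\leqslant B_{n,1}(q)\leqslant B_{n,n-1}(q)\leqslant\cdots\leqslant B_{n,\lfloor (n+1)/2\rfloor}(q)$. If $0\leqslant q\leqslant1$, then $B_n(x,q)$ is spiral: $$B_{n,n}(q)\leqslant B_{n,0}(q)\leqslant B_{n,n-1}(q)\leqslant B_{n,1}(q)\leqslant\cdots\leqslant B_{n,\lfloor n/2\rfloor}(q).$$
   Context: $\mathcal{S}^B_n$ is the group of bijections $\sigma$ of $\{\pm1,\dots,\pm n\}$ with $\sigma(-i)=-\sigma(i)$, written $\sigma(1)\cdots\sigma(n)$. $\mathrm{des}_B(\sigma)=\#\{i\in\{0,1,\dots,n-1\}:\sigma(i)>\sigma(i+1)\}$ with $\sigma(0)=0$, and $\mathrm{neg}(\sigma)=\#\{i\in[n]:\sigma(i)<0\}$.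
   Formalization: The parameter q ranges over the rationals instead of the reals. -}

module Defs where

open import Data.Nat as ℕ using (ℕ; zero; suc; _+_; _∸_)
open import Data.Integer as ℤ using (ℤ; +_; -[1+_]; ∣_∣)
open import Data.Rational as ℚ using (ℚ; 1ℚ; 0ℚ; _≤_)
open import Data.List using (List; []; _∷_; map; concatMap; filter; upTo; length; foldr)
open import Data.Bool using (if_then_else_)
open import Relation.Nullary using (does)
import Data.List.Relation.Unary.Unique.DecPropositional as UniqueDec

-- A signed permutation σ ∈ S^B_n is represented by its window
-- σ(1) ⋯ σ(n): a list of n nonzero integers whose absolute values
-- are pairwise distinct (hence form a permutation of 1..n).

letters : ℕ → List ℤ
letters n = concatMap (λ i → (+ suc i) ∷ -[1+ i ] ∷ []) (upTo n)

words : ℕ → ℕ → List (List ℤ)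
words n zero    = [] ∷ []
words n (suc k) = concatMap (λ x → map (x ∷_) (words n k)) (letters n)

SB : ℕ → List (List ℤ)
SB n = filter (λ w → UniqueDec.unique? ℕ._≟_ (map ∣_∣ w)) (words n n)

descents : List ℤ → ℕ
descents []            = 0
descents (x ∷ [])      = 0
descents (x ∷ y ∷ r)   = (if does (y ℤ.<? x) then 1 else 0) + descents (y ∷ r)

desB : List ℤ → ℕ
desB w = descents (+ 0 ∷ w)

neg : List ℤ → ℕ
neg w = length (filter (λ x → x ℤ.<? + 0) w)

_^_ : ℚ → ℕ → ℚ
q ^ zero  = 1ℚ
q ^ suc k = q ℚ.* (q ^ k)

Bcoef : ℕ → ℚ → ℕ → ℚ
Bcoef n q k = foldr (λ σ acc → (q ^ neg σ) ℚ.+ acc) 0ℚ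
                (filter (λ σ → desB σ ℕ.≟ k) (SB n))

-- a_0 ≤ a_n ≤ a_1 ≤ a_{n-1} ≤ ⋯ ≤ a_{⌊(n+1)/2⌋}
-- i.e. for every i: a_i ≤ a_{n-i} whenever 2i+1 ≤ n,
--                   a_{n-i} ≤ a_{i+1} whenever 2i+2 ≤ n.
AlternatinglyIncreasing : ℕ → (ℕ → ℚ) → Set
AlternatinglyIncreasing n a =
  ∀ i → (2 ℕ.* i + 1 ℕ.≤ n → a i ≤ a (n ∸ i))
      × (2 ℕ.* i + 2 ℕ.≤ n → a (n ∸ i) ≤ a (suc i))
  where open import Data.Product using (_×_)

-- a_n ≤ a_0 ≤ a_{n-1} ≤ a_1 ≤ ⋯ ≤ a_{⌊n/2⌋}
-- i.e. for every i: a_{n-i} ≤ a_i whenever 2i+1 ≤ n,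
--                   a_i ≤ a_{n-i-1} whenever 2i+2 ≤ n.
Spiral : ℕ → (ℕ → ℚ) → Set
Spiral n a =
  ∀ i → (2 ℕ.* i + 1 ℕ.≤ n → a (n ∸ i) ≤ a i)
      × (2 ℕ.* i + 2 ℕ.≤ n → a i ≤ a (n ∸ suc i))
  where open import Data.Product using (_×_)

{-# OPTIONS --safe #-}
-- S^B_{n+1} arises, each element exactly once, by inserting n+1 or -(n+1) into every σ ∈ S^B_n
-- at each of its n+1 positions.  Tracking des_B and neg through these insertions gives
--   B_{n+1,k} = ((k+1) + qk) B_{n,k} + ((n+1-k) + q(n+2-k)) B_{n,k-1}.
-- By this recurrence every comparison between coefficients of B_{n+1} demanded by either chain is
-- a combination of comparisons in the same chain for B_n, with coefficients built from (k+1) + qk,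
-- k + q(k+1) and one of q - 1, 1 - q, 2, 2q, all nonnegative in the relevant range of q; induction
-- on n concludes.
module Submission where

open import Defs
open import Data.Nat using (ℕ; _≥_)
open import Data.Rational using (ℚ; _≤_; 0ℚ; 1ℚ)
open import Data.Product using (_×_)

open import Algebra.Bundles using (CommutativeRing; CommutativeMonoid)
open import Data.Bool using (true; false; if_then_else_)
open import Data.Empty using (⊥-elim)
open import Data.Integer as ℤ using (ℤ; +_; -[1+_]; ∣_∣)
import Data.Integer.Properties as ℤP
open import Data.List using (List; []; _∷_; _++_; map; concatMap; filter; length; upTo; applyUpTo; foldr)
import Data.List.Properties as ListP
open import Data.List.Membership.Propositional using (_∈_; _∉_; find; lose)
open import Data.List.Membership.Propositional.Properties
open import Data.List.Membership.Propositional.Properties.WithK using (unique∧set⇒bag)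
import Data.List.Membership.DecPropositional as DecMembership
open import Data.List.Relation.Binary.BagAndSetEquality using (∼bag⇒↭)
open import Data.List.Relation.Binary.Permutation.Propositional as Perm using (_↭_; ↭-sym; ↭⇒↭ₛ)
import Data.List.Relation.Binary.Permutation.Propositional.Properties as PermP
import Data.List.Relation.Binary.Permutation.Setoid.Properties as PermSetoidP
open import Data.List.Relation.Binary.Subset.Propositional using (_⊆_)
open import Data.List.Relation.Unary.All as All using (All; []; _∷_)
import Data.List.Relation.Unary.All.Properties as AllP
open import Data.List.Relation.Unary.AllPairs using ([]; _∷_)
open import Data.List.Relation.Unary.Any using (here; there; any?)
open import Data.List.Relation.Unary.Unique.Propositional using (Unique)
import Data.List.Relation.Unary.Unique.Propositional.Properties as UniqueP
import Data.List.Relation.Unary.Unique.DecPropositional as UniqueDec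
open import Data.Nat as ℕ using (zero; suc; z≤n; s≤s; _∸_)
import Data.Nat.Properties as ℕP
import Data.Nat.Tactic.RingSolver as ℕ-Solver
open import Data.Product using (∃₂; ∃-syntax; _,_; proj₁; proj₂)
open import Data.Rational as ℚ using (_+_; _*_; _-_)
import Data.Rational.Properties as ℚP
open import Data.Sum using (inj₁; inj₂; [_,_]′)
open import Function using (_∘_)
open import Function.Bundles using (mk⇔)
open import Relation.Binary.Definitions using (DecidableEquality)
open import Relation.Binary.PropositionalEquality
open import Relation.Nullary using (does; ¬_; ¬?; yes; no; Dec)
open import Relation.Nullary.Decidable using (dec-true; dec-false; dec⇒maybe)
open import Tactic.RingSolver using (solve-∀)
open import Tactic.RingSolver.Core.AlmostCommutativeRing using (AlmostCommutativeRing; fromCommutativeRing)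
open import Algebra.Properties.CommutativeSemigroup
  (CommutativeMonoid.commutativeSemigroup ℚP.+-0-commutativeMonoid) using (x∙yz≈y∙xz)
-- k · x is the k-fold sum x + ⋯ + x, so k · 1ℚ is k read as a rational.
open import Algebra.Properties.Semiring.Mult (CommutativeRing.semiring ℚP.+-*-commutativeRing)
  using (×-assoc-*) renaming (_×_ to _·_)

-- Finite sums and order

ℚ-ring : AlmostCommutativeRing _ _
ℚ-ring = fromCommutativeRing ℚP.+-*-commutativeRing (λ x → dec⇒maybe (0ℚ ℚP.≟ x))

0≤1 : 0ℚ ≤ 1ℚ
0≤1 = ℚP.≤ᵇ⇒≤ _

+-nonneg : ∀ {x y} → 0ℚ ≤ x → 0ℚ ≤ y → 0ℚ ≤ x + y
+-nonneg = ℚP.+-mono-≤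

*-nonneg : ∀ {x y} → 0ℚ ≤ x → 0ℚ ≤ y → 0ℚ ≤ x * y
*-nonneg {x} {y} 0≤x 0≤y = subst (_≤ x * y) (ℚP.*-zeroʳ x) (ℚP.*-monoˡ-≤-nonNeg x {{ℚ.nonNegative 0≤x}} 0≤y)

p≤q⇒0≤q-p : ∀ {p q} → p ≤ q → 0ℚ ≤ q - p
p≤q⇒0≤q-p {p} {q} p≤q = subst (_≤ q - p) (ℚP.+-inverseʳ p) (ℚP.+-monoˡ-≤ (ℚ.- p) p≤q)

0≤q-p⇒p≤q : ∀ {p q} → 0ℚ ≤ q - p → p ≤ q
0≤q-p⇒p≤q {p} {q} 0≤q-p = subst₂ _≤_ (ℚP.+-identityʳ p) (p+[q-p]≡q p q) (ℚP.+-monoʳ-≤ p 0≤q-p)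
  where
  p+[q-p]≡q : ∀ p q → p + (q - p) ≡ q
  p+[q-p]≡q = solve-∀ ℚ-ring

≤-by-difference : ∀ {x y} a₁ a₂ a₃ {l₁ u₁ l₂ u₂ l₃ u₃} →
  0ℚ ≤ a₁ → 0ℚ ≤ a₂ → 0ℚ ≤ a₃ → l₁ ≤ u₁ → l₂ ≤ u₂ → l₃ ≤ u₃ →
  y - x ≡ a₁ * (u₁ - l₁) + a₂ * (u₂ - l₂) + a₃ * (u₃ - l₃) → x ≤ y
≤-by-difference a₁ a₂ a₃ 0≤a₁ 0≤a₂ 0≤a₃ l₁≤u₁ l₂≤u₂ l₃≤u₃ y-x≡ =
  0≤q-p⇒p≤q (subst (0ℚ ≤_) (sym y-x≡)
    (+-nonneg (+-nonneg (*-nonneg 0≤a₁ (p≤q⇒0≤q-p l₁≤u₁)) (*-nonneg 0≤a₂ (p≤q⇒0≤q-p l₂≤u₂)))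
              (*-nonneg 0≤a₃ (p≤q⇒0≤q-p l₃≤u₃))))

·1-nonneg : ∀ k → 0ℚ ≤ k · 1ℚ
·1-nonneg zero    = ℚP.≤-refl
·1-nonneg (suc k) = +-nonneg 0≤1 (·1-nonneg k)

^-nonneg : ∀ {q} → 0ℚ ≤ q → ∀ m → 0ℚ ≤ q ^ m
^-nonneg 0≤q zero    = 0≤1
^-nonneg 0≤q (suc m) = *-nonneg 0≤q (^-nonneg 0≤q m)

∑ : ∀ {a} {A : Set a} → List A → (A → ℚ) → ℚ
∑ xs f = foldr (λ x s → f x + s) 0ℚ xs

module _ {a} {A : Set a} where

  ∑-++ : ∀ xs ys (f : A → ℚ) → ∑ (xs ++ ys) f ≡ ∑ xs f + ∑ ys f
  ∑-++ []       ys f = sym (ℚP.+-identityˡ _)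
  ∑-++ (x ∷ xs) ys f = trans (cong (_+_ (f x)) (∑-++ xs ys f)) (sym (ℚP.+-assoc (f x) _ _))

  ∑-cong : ∀ xs {f g : A → ℚ} → (∀ {x} → x ∈ xs → f x ≡ g x) → ∑ xs f ≡ ∑ xs g
  ∑-cong []       f≗g = refl
  ∑-cong (x ∷ xs) f≗g = cong₂ _+_ (f≗g (here refl)) (∑-cong xs (f≗g ∘ there))

  ∑-↭ : ∀ {xs ys} (f : A → ℚ) → xs ↭ ys → ∑ xs f ≡ ∑ ys f
  ∑-↭ f Perm.refl         = refl
  ∑-↭ f (Perm.prep x p)   = cong (_+_ (f x)) (∑-↭ f p)
  ∑-↭ f (Perm.swap x y p) = trans (x∙yz≈y∙xz (f x) (f y) _) (cong (λ s → f y + (f x + s)) (∑-↭ f p))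
  ∑-↭ f (Perm.trans p q)  = trans (∑-↭ f p) (∑-↭ f q)

  ∑-+ : ∀ xs (f g : A → ℚ) → ∑ xs (λ x → f x + g x) ≡ ∑ xs f + ∑ xs g
  ∑-+ []       f g = refl
  ∑-+ (x ∷ xs) f g = begin
    (f x + g x) + ∑ xs (λ x → f x + g x) ≡⟨ cong (_+_ (f x + g x)) (∑-+ xs f g) ⟩
    (f x + g x) + (∑ xs f + ∑ xs g)      ≡⟨ ℚP.+-assoc (f x) (g x) _ ⟩
    f x + (g x + (∑ xs f + ∑ xs g))      ≡⟨ cong (_+_ (f x)) (x∙yz≈y∙xz (g x) (∑ xs f) _) ⟩
    f x + (∑ xs f + (g x + ∑ xs g))      ≡⟨ ℚP.+-assoc (f x) (∑ xs f) _ ⟨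
    (f x + ∑ xs f) + (g x + ∑ xs g)      ∎
    where open ≡-Reasoning

  ∑-*ˡ : ∀ xs c (f : A → ℚ) → ∑ xs (λ x → c * f x) ≡ c * ∑ xs f
  ∑-*ˡ []       c f = sym (ℚP.*-zeroʳ c)
  ∑-*ˡ (x ∷ xs) c f = trans (cong (_+_ (c * f x)) (∑-*ˡ xs c f)) (sym (ℚP.*-distribˡ-+ c (f x) _))

  ∑-*ʳ : ∀ xs c (f : A → ℚ) → ∑ xs (λ x → f x * c) ≡ ∑ xs f * c
  ∑-*ʳ xs c f = trans (∑-cong xs (λ {x} _ → ℚP.*-comm (f x) c)) (trans (∑-*ˡ xs c f) (ℚP.*-comm c _))

  ∑-map : ∀ {b} {B : Set b} (h : B → A) xs (f : A → ℚ) → ∑ (map h xs) f ≡ ∑ xs (f ∘ h)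
  ∑-map h xs f = ListP.foldr-map _ h 0ℚ xs

  ∑-concatMap : ∀ {b} {B : Set b} (h : B → List A) xs (f : A → ℚ) →
                ∑ (concatMap h xs) f ≡ ∑ xs (λ y → ∑ (h y) f)
  ∑-concatMap h []       f = refl
  ∑-concatMap h (y ∷ ys) f = trans (∑-++ (h y) _ f) (cong (_+_ (∑ (h y) f)) (∑-concatMap h ys f))

  ∑-filter : ∀ {p} {P : A → Set p} (P? : ∀ x → Dec (P x)) xs (f : A → ℚ) →
             ∑ (filter P? xs) f ≡ ∑ xs (λ x → if does (P? x) then f x else 0ℚ)
  ∑-filter P? []       f = refl
  ∑-filter P? (x ∷ xs) f with does (P? x)
  ... | true  = cong (_+_ (f x)) (∑-filter P? xs f)
  ... | false = trans (∑-filter P? xs f) (sym (ℚP.+-identityˡ _))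

  ∑-nonneg : ∀ xs {f : A → ℚ} → (∀ x → 0ℚ ≤ f x) → 0ℚ ≤ ∑ xs f
  ∑-nonneg []       0≤f = ℚP.≤-refl
  ∑-nonneg (x ∷ xs) 0≤f = +-nonneg (0≤f x) (∑-nonneg xs 0≤f)

-- Insertions and signed permutations

module _ {a b} {A : Set a} {B : Set b} where

  concatMap-unique : ∀ (f : A → List B) {xs} → Unique xs → (∀ {x} → x ∈ xs → Unique (f x)) →
                     (∀ {x y z} → x ∈ xs → y ∈ xs → z ∈ f x → z ∈ f y → x ≡ y) →
                     Unique (concatMap f xs)
  concatMap-unique f {[]}     _          _        _     = []
  concatMap-unique f {x ∷ xs} (x∉ ∷ xs!) f-unique f-inj =
    UniqueP.++⁺ (f-unique (here refl))
                (concatMap-unique f xs! (f-unique ∘ there) (λ x∈ y∈ → f-inj (there x∈) (there y∈)))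
                disjoint
    where
    disjoint : ∀ {z} → ¬ (z ∈ f x × z ∈ concatMap f xs)
    disjoint (z∈fx , z∈rest) with y , y∈xs , z∈fy ← find (∈-concatMap⁻ f {xs = xs} z∈rest) =
      All.lookup x∉ y∈xs (f-inj (here refl) (there y∈xs) z∈fx z∈fy)

module _ {a} {A : Set a} where

  unique∧set⇒↭ : ∀ {xs ys : List A} → Unique xs → Unique ys → xs ⊆ ys → ys ⊆ xs → xs ↭ ys
  unique∧set⇒↭ xs! ys! xs⊆ys ys⊆xs = ∼bag⇒↭ (unique∧set⇒bag xs! ys! (mk⇔ xs⊆ys ys⊆xs))

  unique∧⊆⇒length≤ : DecidableEquality A → ∀ {xs ys : List A} →
                     Unique xs → Unique ys → xs ⊆ ys → length xs ℕ.≤ length ys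
  unique∧⊆⇒length≤ _≟_ {xs} {ys} xs! ys! xs⊆ys = begin
    length xs                   ≡⟨ PermP.↭-length xs↭ys∩xs ⟩
    length (filter (_∈? xs) ys) ≤⟨ ListP.length-filter (_∈? xs) ys ⟩
    length ys                   ∎
    where
    open DecMembership _≟_ using (_∈?_)
    open ℕP.≤-Reasoning
    xs↭ys∩xs : xs ↭ filter (_∈? xs) ys
    xs↭ys∩xs = unique∧set⇒↭ xs! (UniqueP.filter⁺ (_∈? xs) ys!)
                 (λ x∈xs → ∈-filter⁺ (_∈? xs) (xs⊆ys x∈xs) x∈xs)
                 (proj₂ ∘ ∈-filter⁻ (_∈? xs) {xs = ys})

  insertions : A → List A → List (List A)
  insertions x []      = (x ∷ []) ∷ []
  insertions x (y ∷ w) = (x ∷ y ∷ w) ∷ map (y ∷_) (insertions x w)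

  ∈-insertions⁺ : ∀ x u u′ → u ++ x ∷ u′ ∈ insertions x (u ++ u′)
  ∈-insertions⁺ x []      []       = here refl
  ∈-insertions⁺ x []      (y ∷ u′) = here refl
  ∈-insertions⁺ x (y ∷ u) u′       = there (∈-map⁺ (y ∷_) (∈-insertions⁺ x u u′))

  ∈-insertions⁻ : ∀ {x} w {v} → v ∈ insertions x w → ∃₂ λ u u′ → w ≡ u ++ u′ × v ≡ u ++ x ∷ u′
  ∈-insertions⁻ []      (here refl) = [] , [] , refl , refl
  ∈-insertions⁻ (y ∷ w) (here refl) = [] , y ∷ w , refl , refl
  ∈-insertions⁻ (y ∷ w) (there v∈)
    with v′ , v′∈ , refl ← ∈-map⁻ (y ∷_) v∈
    with u , u′ , refl , refl ← ∈-insertions⁻ w v′∈ = y ∷ u , u′ , refl , refl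

  insertion-↭ : ∀ {x w v} → v ∈ insertions x w → v ↭ x ∷ w
  insertion-↭ {x} {w} v∈ with u , u′ , refl , refl ← ∈-insertions⁻ w v∈ = PermP.shift x u u′

  insertions-unique : ∀ {x} w → x ∉ w → Unique (insertions x w)
  insertions-unique []      x∉ = [] ∷ []
  insertions-unique {x} (y ∷ w) x∉ =
    All.tabulate new-head ∷ UniqueP.map⁺ ListP.∷-injectiveʳ (insertions-unique w (x∉ ∘ there))
    where
    new-head : ∀ {v} → v ∈ map (y ∷_) (insertions x w) → x ∷ y ∷ w ≢ v
    new-head v∈ refl with _ , _ , x∷y∷w≡y∷v′ ← ∈-map⁻ (y ∷_) v∈ =
      x∉ (here (ListP.∷-injectiveˡ x∷y∷w≡y∷v′))

  filter-insertion : ∀ {p} {P : A → Set p} (P? : ∀ x → Dec (P x)) {x w v} →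
                     ¬ P x → All P w → v ∈ insertions x w → filter P? v ≡ w
  filter-insertion P? {x} {w} ¬Px Pw v∈ with u , u′ , refl , refl ← ∈-insertions⁻ w v∈ = begin
    filter P? (u ++ x ∷ u′)        ≡⟨ ListP.filter-++ P? u (x ∷ u′) ⟩
    filter P? u ++ filter P? (x ∷ u′) ≡⟨ cong (filter P? u ++_) (ListP.filter-reject P? ¬Px) ⟩
    filter P? u ++ filter P? u′    ≡⟨ ListP.filter-++ P? u u′ ⟨
    filter P? (u ++ u′)            ≡⟨ ListP.filter-all P? Pw ⟩
    u ++ u′                        ∎
    where open ≡-Reasoning

signedPair : ℕ → List ℤ
signedPair i = + suc i ∷ -[1+ i ] ∷ []

∣signedPair∣ : ∀ {i x} → x ∈ signedPair i → ∣ x ∣ ≡ suc i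
∣signedPair∣ (here refl)         = refl
∣signedPair∣ (there (here refl)) = refl

∈-letters⁻ : ∀ {n x} → x ∈ letters n → ∃[ i ] i ℕ.< n × ∣ x ∣ ≡ suc i
∈-letters⁻ {n} x∈ with i , i∈ , x∈pair ← find (∈-concatMap⁻ signedPair {xs = upTo n} x∈) =
  i , ∈-upTo⁻ i∈ , ∣signedPair∣ x∈pair

∈-letters⁺ : ∀ {n x i} → i ℕ.< n → ∣ x ∣ ≡ suc i → x ∈ letters n
∈-letters⁺ {n} {+ _}      i<n refl = ∈-concatMap⁺ signedPair {xs = upTo n} (lose (∈-upTo⁺ i<n) (here refl))
∈-letters⁺ {n} { -[1+ _ ]} i<n refl =
  ∈-concatMap⁺ signedPair {xs = upTo n} (lose (∈-upTo⁺ i<n) (there (here refl)))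

letters-unique : ∀ n → Unique (letters n)
letters-unique n = concatMap-unique signedPair (UniqueP.upTo⁺ n) (λ _ → ((λ ()) ∷ []) ∷ [] ∷ [])
  λ _ _ x∈i x∈j → ℕP.suc-injective (trans (sym (∣signedPair∣ x∈i)) (∣signedPair∣ x∈j))

letter-lift : ∀ {n x} → x ∈ letters n → x ∈ letters (suc n)
letter-lift {n} x∈ with i , i<n , ∣x∣≡1+i ← ∈-letters⁻ {n} x∈ = ∈-letters⁺ (ℕP.m<n⇒m<1+n i<n) ∣x∣≡1+i

letter-top : ∀ {n x} → ∣ x ∣ ≡ suc n → x ∈ letters (suc n)
letter-top = ∈-letters⁺ ℕP.≤-refl

letter-≢top : ∀ {n x} → x ∈ letters n → ∣ x ∣ ≢ suc n
letter-≢top {n} x∈ ∣x∣≡1+n with i , i<n , ∣x∣≡1+i ← ∈-letters⁻ {n} x∈ =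
  ℕP.<-irrefl (ℕP.suc-injective (trans (sym ∣x∣≡1+i) ∣x∣≡1+n)) i<n

letter-drop : ∀ {n x} → x ∈ letters (suc n) → ∣ x ∣ ≢ suc n → x ∈ letters n
letter-drop {n} x∈ ∣x∣≢1+n with i , i<1+n , ∣x∣≡1+i ← ∈-letters⁻ {suc n} x∈ =
  ∈-letters⁺ (ℕP.≤∧≢⇒< (ℕP.≤-pred i<1+n) (∣x∣≢1+n ∘ trans ∣x∣≡1+i ∘ cong suc)) ∣x∣≡1+i

letter<top : ∀ {n x} → x ∈ letters n → x ℤ.< + suc n
letter<top {n} {+ _}      x∈ with _ , i<n , refl ← ∈-letters⁻ {n} x∈ = ℤ.+<+ (s≤s i<n)
letter<top {n} { -[1+ _ ]} x∈ = ℤ.-<+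

letter>bottom : ∀ {n x} → x ∈ letters n → -[1+ n ] ℤ.< x
letter>bottom {n} {+ _}      x∈ = ℤ.-<+
letter>bottom {n} { -[1+ _ ]} x∈ with _ , i<n , refl ← ∈-letters⁻ {n} x∈ = ℤ.-<- i<n

∈-words⁻ : ∀ {n} k {w} → w ∈ words n k → length w ≡ k × All (_∈ letters n) w
∈-words⁻ zero    (here refl) = refl , []
∈-words⁻ {n} (suc k) w∈
  with x , x∈ , w∈x∷ ← find (∈-concatMap⁻ (λ x → map (x ∷_) (words n k)) {xs = letters n} w∈)
  with w′ , w′∈ , refl ← ∈-map⁻ (x ∷_) w∈x∷
  with len , w′-letters ← ∈-words⁻ k w′∈ = cong suc len , x∈ ∷ w′-letters

∈-words⁺ : ∀ {n} w → All (_∈ letters n) w → w ∈ words n (length w)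
∈-words⁺ []      []         = here refl
∈-words⁺ {n} (x ∷ w) (x∈ ∷ w-letters) =
  ∈-concatMap⁺ (λ x → map (x ∷_) (words n (length w))) {xs = letters n}
    (lose x∈ (∈-map⁺ (x ∷_) (∈-words⁺ w w-letters)))

words-unique : ∀ n k → Unique (words n k)
words-unique n zero    = [] ∷ []
words-unique n (suc k) =
  concatMap-unique (λ x → map (x ∷_) (words n k)) (letters-unique n)
    (λ _ → UniqueP.map⁺ ListP.∷-injectiveʳ (words-unique n k))
    λ _ _ → same-head
  where
  same-head : ∀ {x y : ℤ} {w ws ws′} → w ∈ map (x ∷_) ws → w ∈ map (y ∷_) ws′ → x ≡ y
  same-head w∈x∷ w∈y∷ with _ , _ , refl ← ∈-map⁻ _ w∈x∷ | _ , _ , x∷≡y∷ ← ∈-map⁻ _ w∈y∷ =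
    ListP.∷-injectiveˡ x∷≡y∷

IsSignedPermutation : ℕ → List ℤ → Set
IsSignedPermutation n w = length w ≡ n × All (_∈ letters n) w × Unique (map ∣_∣ w)

private
  absUnique? : ∀ w → Dec (Unique (map ∣_∣ w))
  absUnique? w = UniqueDec.unique? ℕ._≟_ (map ∣_∣ w)

∈-SB⁻ : ∀ {n w} → w ∈ SB n → IsSignedPermutation n w
∈-SB⁻ {n} w∈ with w∈words , w! ← ∈-filter⁻ absUnique? {xs = words n n} w∈
             with len , w-letters ← ∈-words⁻ n w∈words = len , w-letters , w!

∈-SB⁺ : ∀ {n w} → IsSignedPermutation n w → w ∈ SB n
∈-SB⁺ {n} {w} (refl , w-letters , w!) = ∈-filter⁺ absUnique? {xs = words n n} (∈-words⁺ w w-letters) w!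

SB-unique : ∀ n → Unique (SB n)
SB-unique n = UniqueP.filter⁺ absUnique? (words-unique n n)

signedPermutation-resp-↭ : ∀ {n v w} → v ↭ w → IsSignedPermutation n w → IsSignedPermutation n v
signedPermutation-resp-↭ v↭w (len , w-letters , w!) =
  trans (PermP.↭-length v↭w) len ,
  PermP.All-resp-↭ (↭-sym v↭w) w-letters ,
  PermSetoidP.Unique-resp-↭ (setoid ℕ) (↭⇒↭ₛ (PermP.map⁺ ∣_∣ (↭-sym v↭w))) w!

signedPermutation-∷ : ∀ {n x σ} → IsSignedPermutation n σ → ∣ x ∣ ≡ suc n →
                      IsSignedPermutation (suc n) (x ∷ σ)
signedPermutation-∷ {n} (len , σ-letters , σ!) ∣x∣≡1+n =
  cong suc len ,
  letter-top ∣x∣≡1+n ∷ All.map (letter-lift {n}) σ-letters ,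
  AllP.map⁺ (All.map (λ y∈ ∣x∣≡∣y∣ → letter-≢top {n} y∈ (trans (sym ∣x∣≡∣y∣) ∣x∣≡1+n)) σ-letters) ∷ σ!

signedPermutation-∷⁻ : ∀ {n x σ} → IsSignedPermutation (suc n) (x ∷ σ) → ∣ x ∣ ≡ suc n →
                       IsSignedPermutation n σ
signedPermutation-∷⁻ (len , _ ∷ σ-letters , ∣x∣∉ ∷ σ!) ∣x∣≡1+n =
  ℕP.suc-injective len ,
  All.zipWith (λ (y∈ , ∣x∣≢∣y∣) → letter-drop y∈ (∣x∣≢∣y∣ ∘ trans ∣x∣≡1+n ∘ sym))
              (σ-letters , AllP.map⁻ ∣x∣∉) ,
  σ!

-- Pigeonhole: otherwise the n+1 distinct absolute values would all lie in {1, …, n}.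
top-letter : ∀ {n v} → IsSignedPermutation (suc n) v → ∃[ x ] x ∈ v × ∣ x ∣ ≡ suc n
top-letter {n} {v} (len , v-letters , v!) with any? (λ x → ∣ x ∣ ℕ.≟ suc n) v
... | yes has-top = find has-top
... | no  no-top  = ⊥-elim (ℕP.<-irrefl refl (subst₂ ℕ._≤_ length-abs (ListP.length-applyUpTo suc n)
                      (unique∧⊆⇒length≤ ℕ._≟_ v! 1…n-unique abs⊆1…n)))
  where
  length-abs : length (map ∣_∣ v) ≡ suc n
  length-abs = trans (ListP.length-map ∣_∣ v) len
  1…n-unique : Unique (applyUpTo suc n)
  1…n-unique = UniqueP.applyUpTo⁺₁ suc n (λ i<j _ → ℕP.<⇒≢ i<j ∘ ℕP.suc-injective)
  abs⊆1…n : map ∣_∣ v ⊆ applyUpTo suc n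
  abs⊆1…n m∈ with y , y∈v , refl ← ∈-map⁻ ∣_∣ m∈
             with i , i<n , ∣y∣≡1+i ← ∈-letters⁻ {n} (letter-drop (All.lookup v-letters y∈v) (no-top ∘ lose y∈v)) =
    subst (_∈ applyUpTo suc n) (sym ∣y∣≡1+i) (∈-applyUpTo⁺ suc i<n)

extensions : ℕ → List ℤ → List (List ℤ)
extensions n σ = insertions (+ suc n) σ ++ insertions -[1+ n ] σ

∈-extensions⁻ : ∀ {n σ v} → v ∈ extensions n σ → ∃[ x ] ∣ x ∣ ≡ suc n × v ∈ insertions x σ
∈-extensions⁻ {n} {σ} v∈ with ∈-++⁻ (insertions (+ suc n) σ) v∈
... | inj₁ v∈₊ = + suc n , refl , v∈₊
... | inj₂ v∈₋ = -[1+ n ] , refl , v∈₋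

∈-extensions⁺ : ∀ {n σ v x} → ∣ x ∣ ≡ suc n → v ∈ insertions x σ → v ∈ extensions n σ
∈-extensions⁺ {x = + _}      refl v∈ = ∈-++⁺ˡ v∈
∈-extensions⁺ {x = -[1+ _ ]} refl v∈ = ∈-++⁺ʳ _ v∈

top∉ : ∀ {n σ x} → σ ∈ SB n → ∣ x ∣ ≡ suc n → x ∉ σ
top∉ {n} σ∈ ∣x∣≡1+n x∈σ = letter-≢top {n} (All.lookup (proj₁ (proj₂ (∈-SB⁻ {n} σ∈))) x∈σ) ∣x∣≡1+n

extensions-unique : ∀ {n σ} → σ ∈ SB n → Unique (extensions n σ)
extensions-unique {n} {σ} σ∈ =
  UniqueP.++⁺ (insertions-unique σ (top∉ σ∈ refl)) (insertions-unique σ (top∉ σ∈ refl)) disjoint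
  where
  disjoint : ∀ {v} → ¬ (v ∈ insertions (+ suc n) σ × v ∈ insertions -[1+ n ] σ)
  disjoint (v∈₊ , v∈₋) with PermP.∈-resp-↭ (insertion-↭ v∈₋) (PermP.∈-resp-↭ (↭-sym (insertion-↭ v∈₊)) (here refl))
  ... | there top∈σ = top∉ σ∈ refl top∈σ

extension-erase : ∀ {n σ v} → σ ∈ SB n → v ∈ extensions n σ →
                  filter (λ y → ¬? (∣ y ∣ ℕ.≟ suc n)) v ≡ σ
extension-erase {n} σ∈ v∈ with _ , ∣x∣≡1+n , v∈ins ← ∈-extensions⁻ v∈ =
  filter-insertion _ (λ ∣x∣≢1+n → ∣x∣≢1+n ∣x∣≡1+n)
    (All.map (letter-≢top {n}) (proj₁ (proj₂ (∈-SB⁻ {n} σ∈)))) v∈ins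

extension∈SB : ∀ {n σ v} → σ ∈ SB n → v ∈ extensions n σ → v ∈ SB (suc n)
extension∈SB σ∈ v∈ with _ , ∣x∣≡1+n , v∈ins ← ∈-extensions⁻ v∈ =
  ∈-SB⁺ (signedPermutation-resp-↭ (insertion-↭ v∈ins) (signedPermutation-∷ (∈-SB⁻ σ∈) ∣x∣≡1+n))

SB-extension : ∀ {n v} → v ∈ SB (suc n) → ∃[ σ ] σ ∈ SB n × v ∈ extensions n σ
SB-extension v∈ with x , x∈v , ∣x∣≡1+n ← top-letter (∈-SB⁻ v∈)
                with u , u′ , refl ← ∈-∃++ x∈v =
  u ++ u′ ,
  ∈-SB⁺ (signedPermutation-∷⁻ (signedPermutation-resp-↭ (↭-sym (PermP.shift x u u′)) (∈-SB⁻ v∈)) ∣x∣≡1+n) ,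
  ∈-extensions⁺ ∣x∣≡1+n (∈-insertions⁺ x u u′)

SB-suc-↭ : ∀ n → SB (suc n) ↭ concatMap (extensions n) (SB n)
SB-suc-↭ n = unique∧set⇒↭ (SB-unique (suc n)) extensions!
  (λ v∈ → let σ , σ∈ , v∈ext = SB-extension v∈ in ∈-concatMap⁺ (extensions n) (lose σ∈ v∈ext))
  (λ v∈ → let σ , σ∈ , v∈ext = find (∈-concatMap⁻ (extensions n) v∈) in extension∈SB {n} σ∈ v∈ext)
  where
  extensions! : Unique (concatMap (extensions n) (SB n))
  extensions! = concatMap-unique (extensions n) (SB-unique n) extensions-unique
    λ σ∈ τ∈ v∈σ v∈τ → trans (sym (extension-erase σ∈ v∈σ)) (extension-erase τ∈ v∈τ)

-- Descents under insertion of an extreme letter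

ascents : List ℤ → ℕ
ascents []          = 0
ascents (x ∷ [])    = 0
ascents (x ∷ y ∷ r) = (if does (y ℤ.<? x) then 0 else 1) ℕ.+ ascents (y ∷ r)

module _ {x y : ℤ} (r : List ℤ) where

  descents-< : y ℤ.< x → descents (x ∷ y ∷ r) ≡ suc (descents (y ∷ r))
  descents-< y<x rewrite dec-true (y ℤ.<? x) y<x = refl

  descents-≮ : ¬ y ℤ.< x → descents (x ∷ y ∷ r) ≡ descents (y ∷ r)
  descents-≮ y≮x rewrite dec-false (y ℤ.<? x) y≮x = refl

descents+ascents : ∀ p w → descents (p ∷ w) ℕ.+ ascents (p ∷ w) ≡ length w
descents+ascents p []      = refl
descents+ascents p (y ∷ w) with y ℤ.<? p
... | yes _ = cong suc (descents+ascents y w)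
... | no  _ = trans (ℕP.+-suc (descents (y ∷ w)) _) (cong suc (descents+ascents y w))

-- Inserted into a descent of p w or at its end, the new maximum x keeps the number of descents;
-- inserted into an ascent it adds one.
∑-insertions-max : ∀ {x} p w → All (ℤ._< x) (p ∷ w) → (g : ℕ → ℚ) →
  ∑ (insertions x w) (λ v → g (descents (p ∷ v))) ≡
  suc (descents (p ∷ w)) · g (descents (p ∷ w)) + ascents (p ∷ w) · g (suc (descents (p ∷ w)))
∑-insertions-max p []      (p<x ∷ []) g rewrite descents-≮ [] (ℤP.<-asym p<x) = sym (ℚP.+-identityʳ _)
∑-insertions-max {x} p (y ∷ w) (p<x ∷ y<x ∷ w<x) g
  rewrite descents-≮ (y ∷ w) (ℤP.<-asym p<x) | descents-< w y<x
        | ∑-map (y ∷_) (insertions x w) (λ v → g (descents (p ∷ v)))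
  with y ℤ.<? p
... | yes _ = begin
  g (suc d) + ∑ (insertions x w) (λ v → g (suc (descents (y ∷ v))))
    ≡⟨ cong (_+_ (g (suc d))) (∑-insertions-max y w (y<x ∷ w<x) (g ∘ suc)) ⟩
  g (suc d) + (suc d · g (suc d) + a · g (suc (suc d)))
    ≡⟨ ℚP.+-assoc (g (suc d)) (suc d · g (suc d)) _ ⟨
  suc (suc d) · g (suc d) + a · g (suc (suc d))                      ∎
  where open ≡-Reasoning
        d = descents (y ∷ w)
        a = ascents (y ∷ w)
... | no  _ = begin
  g (suc d) + ∑ (insertions x w) (λ v → g (descents (y ∷ v)))
    ≡⟨ cong (_+_ (g (suc d))) (∑-insertions-max y w (y<x ∷ w<x) g) ⟩
  g (suc d) + (suc d · g d + a · g (suc d))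
    ≡⟨ x∙yz≈y∙xz (g (suc d)) (suc d · g d) _ ⟩
  suc d · g d + suc a · g (suc d)                                    ∎
  where open ≡-Reasoning
        d = descents (y ∷ w)
        a = ascents (y ∷ w)

-- Inserted into a descent of p w, the new minimum x keeps the number of descents; inserted into
-- an ascent or at the end it adds one.
∑-insertions-min : ∀ {x} p w → All (x ℤ.<_) (p ∷ w) → (g : ℕ → ℚ) →
  ∑ (insertions x w) (λ v → g (descents (p ∷ v))) ≡
  descents (p ∷ w) · g (descents (p ∷ w)) + suc (ascents (p ∷ w)) · g (suc (descents (p ∷ w)))
∑-insertions-min p []      (x<p ∷ []) g rewrite descents-< [] x<p = sym (ℚP.+-identityˡ _)
∑-insertions-min {x} p (y ∷ w) (x<p ∷ x<y ∷ x<w) g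
  rewrite descents-< (y ∷ w) x<p | descents-≮ w (ℤP.<-asym x<y)
        | ∑-map (y ∷_) (insertions x w) (λ v → g (descents (p ∷ v)))
  with y ℤ.<? p
... | yes _ = begin
  g (suc d) + ∑ (insertions x w) (λ v → g (suc (descents (y ∷ v))))
    ≡⟨ cong (_+_ (g (suc d))) (∑-insertions-min y w (x<y ∷ x<w) (g ∘ suc)) ⟩
  g (suc d) + (d · g (suc d) + suc a · g (suc (suc d)))
    ≡⟨ ℚP.+-assoc (g (suc d)) (d · g (suc d)) _ ⟨
  suc d · g (suc d) + suc a · g (suc (suc d))                        ∎
  where open ≡-Reasoning
        d = descents (y ∷ w)
        a = ascents (y ∷ w)
... | no  _ = begin
  g (suc d) + ∑ (insertions x w) (λ v → g (descents (y ∷ v)))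
    ≡⟨ cong (_+_ (g (suc d))) (∑-insertions-min y w (x<y ∷ x<w) g) ⟩
  g (suc d) + (d · g d + suc a · g (suc d))
    ≡⟨ x∙yz≈y∙xz (g (suc d)) (d · g d) _ ⟩
  d · g d + suc (suc a) · g (suc d)                                  ∎
  where open ≡-Reasoning
        d = descents (y ∷ w)
        a = ascents (y ∷ w)

descents≤length : ∀ p w → descents (p ∷ w) ℕ.≤ length w
descents≤length p w = subst (descents (p ∷ w) ℕ.≤_) (descents+ascents p w) (ℕP.m≤m+n _ _)

ascents≡length∸descents : ∀ p w → ascents (p ∷ w) ≡ length w ∸ descents (p ∷ w)
ascents≡length∸descents p w =
  trans (sym (ℕP.m+n∸m≡n (descents (p ∷ w)) _)) (cong (_∸ descents (p ∷ w)) (descents+ascents p w))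

neg-insertion : ∀ {x w v} → v ∈ insertions x w → neg v ≡ neg (x ∷ w)
neg-insertion v∈ = PermP.↭-length (PermP.filter-↭ (ℤ._<? + 0) (insertion-↭ v∈))

-- The recurrence for B_{n,k}

-- Bsum n q g = Σₖ B_{n,k}(q) g(k)
Bsum : ℕ → ℚ → (ℕ → ℚ) → ℚ
Bsum n q g = ∑ (SB n) (λ σ → g (desB σ) * q ^ neg σ)

-- Counting -(n+1) with weight q, σ has keep q (des_B σ) extensions with the same des_B and
-- rise q a extensions with des_B raised by one, a being the number of ascents of 0σ.
keep rise : ℚ → ℕ → ℚ
keep q k = suc k · 1ℚ + q * (k · 1ℚ)
rise q k = k · 1ℚ + q * (suc k · 1ℚ)

·≡·1* : ∀ k x → k · x ≡ (k · 1ℚ) * x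
·≡·1* k x = sym (trans (×-assoc-* k 1ℚ x) (cong (k ·_) (ℚP.*-identityˡ x)))

extension-weights : ∀ q d a x y Q →
  (suc d · x + a · y) * Q + (d · x + suc a · y) * (q * Q) ≡ (keep q d * x + rise q a * y) * Q
extension-weights q d a x y Q = begin
  (suc d · x + a · y) * Q + (d · x + suc a · y) * (q * Q)
    ≡⟨ cong₂ (λ s t → s * Q + t * (q * Q)) (cong₂ _+_ (·≡·1* (suc d) x) (·≡·1* a y))
                                          (cong₂ _+_ (·≡·1* d x) (·≡·1* (suc a) y)) ⟩
  ((suc d · 1ℚ) * x + (a · 1ℚ) * y) * Q + ((d · 1ℚ) * x + (suc a · 1ℚ) * y) * (q * Q)
    ≡⟨ collect q (suc d · 1ℚ) (d · 1ℚ) (a · 1ℚ) (suc a · 1ℚ) x y Q ⟩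
  (keep q d * x + rise q a * y) * Q ∎
  where
  open ≡-Reasoning
  collect : ∀ q D₁ D A A₁ x y Q →
    (D₁ * x + A * y) * Q + (D * x + A₁ * y) * (q * Q) ≡ ((D₁ + q * D) * x + (A + q * A₁) * y) * Q
  collect = solve-∀ ℚ-ring

∑-extensions : ∀ {n σ} → σ ∈ SB n → ∀ q (g : ℕ → ℚ) →
  ∑ (extensions n σ) (λ v → g (desB v) * q ^ neg v) ≡
  (keep q (desB σ) * g (desB σ) + rise q (ascents (+ 0 ∷ σ)) * g (suc (desB σ))) * q ^ neg σ
∑-extensions {n} {σ} σ∈ q g = begin
  ∑ (insertions (+ suc n) σ ++ insertions -[1+ n ] σ) F
    ≡⟨ ∑-++ (insertions (+ suc n) σ) _ F ⟩
  ∑ (insertions (+ suc n) σ) F + ∑ (insertions -[1+ n ] σ) F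
    ≡⟨ cong₂ _+_ (∑-cong (insertions (+ suc n) σ) neg-invariant)
                 (∑-cong (insertions -[1+ n ] σ) neg-invariant) ⟩
  ∑ (insertions (+ suc n) σ) (λ v → G v * Q) + ∑ (insertions -[1+ n ] σ) (λ v → G v * (q * Q))
    ≡⟨ cong₂ _+_ (∑-*ʳ (insertions (+ suc n) σ) Q G) (∑-*ʳ (insertions -[1+ n ] σ) (q * Q) G) ⟩
  ∑ (insertions (+ suc n) σ) G * Q + ∑ (insertions -[1+ n ] σ) G * (q * Q)
    ≡⟨ cong₂ (λ s t → s * Q + t * (q * Q)) (∑-insertions-max (+ 0) σ below-top g)
                                          (∑-insertions-min (+ 0) σ above-bottom g) ⟩
  (suc d · g d + a · g (suc d)) * Q + (d · g d + suc a · g (suc d)) * (q * Q)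
    ≡⟨ extension-weights q d a (g d) (g (suc d)) Q ⟩
  (keep q d * g d + rise q a * g (suc d)) * Q ∎
  where
  open ≡-Reasoning
  d = desB σ
  a = ascents (+ 0 ∷ σ)
  Q = q ^ neg σ
  G : List ℤ → ℚ
  G v = g (desB v)
  F : List ℤ → ℚ
  F v = G v * q ^ neg v
  neg-invariant : ∀ {x v} → v ∈ insertions x σ → F v ≡ G v * q ^ neg (x ∷ σ)
  neg-invariant {v = v} v∈ = cong (λ m → G v * q ^ m) (neg-insertion v∈)
  σ-letters = proj₁ (proj₂ (∈-SB⁻ {n} σ∈))
  below-top : All (ℤ._< + suc n) (+ 0 ∷ σ)
  below-top = ℤ.+<+ (s≤s z≤n) ∷ All.map (letter<top {n}) σ-letters
  above-bottom : All (-[1+ n ] ℤ.<_) (+ 0 ∷ σ)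
  above-bottom = ℤ.-<+ ∷ All.map (letter>bottom {n}) σ-letters

Bsum-suc : ∀ n q g → Bsum (suc n) q g ≡ Bsum n q (λ d → keep q d * g d + rise q (n ∸ d) * g (suc d))
Bsum-suc n q g = begin
  ∑ (SB (suc n)) F                                    ≡⟨ ∑-↭ F (SB-suc-↭ n) ⟩
  ∑ (concatMap (extensions n) (SB n)) F               ≡⟨ ∑-concatMap (extensions n) (SB n) F ⟩
  ∑ (SB n) (λ σ → ∑ (extensions n σ) F)               ≡⟨ ∑-cong (SB n) extend ⟩
  Bsum n q (λ d → keep q d * g d + rise q (n ∸ d) * g (suc d)) ∎
  where
  open ≡-Reasoning
  F : List ℤ → ℚ
  F v = g (desB v) * q ^ neg v
  extend : ∀ {σ} → σ ∈ SB n → ∑ (extensions n σ) F ≡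
           (keep q (desB σ) * g (desB σ) + rise q (n ∸ desB σ) * g (suc (desB σ))) * q ^ neg σ
  extend {σ} σ∈ = trans (∑-extensions σ∈ q g)
    (cong (λ a → (keep q (desB σ) * g (desB σ) + rise q a * g (suc (desB σ))) * q ^ neg σ)
          (trans (ascents≡length∸descents (+ 0) σ) (cong (_∸ desB σ) (proj₁ (∈-SB⁻ {n} σ∈)))))

δ : ℕ → ℕ → ℚ
δ k d = if does (d ℕ.≟ k) then 1ℚ else 0ℚ

δ-absorb : ∀ (f : ℕ → ℚ) k d → f d * δ k d ≡ f k * δ k d
δ-absorb f k d with d ℕ.≟ k
... | yes refl = refl
... | no  d≢k  = trans (*δ-off (f d)) (sym (*δ-off (f k)))
  where
  *δ-off : ∀ x → x * δ k d ≡ 0ℚ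
  *δ-off x = trans (cong (λ b → x * (if b then 1ℚ else 0ℚ)) (dec-false (d ℕ.≟ k) d≢k)) (ℚP.*-zeroʳ x)

Bcoef≡Bsum : ∀ n q k → Bcoef n q k ≡ Bsum n q (δ k)
Bcoef≡Bsum n q k = trans (∑-filter (λ σ → desB σ ℕ.≟ k) (SB n) (λ σ → q ^ neg σ))
                         (∑-cong (SB n) (λ {σ} _ → if≡δ* (does (desB σ ℕ.≟ k)) (q ^ neg σ)))
  where
  if≡δ* : ∀ b x → (if b then x else 0ℚ) ≡ (if b then 1ℚ else 0ℚ) * x
  if≡δ* true  x = sym (ℚP.*-identityˡ x)
  if≡δ* false x = sym (ℚP.*-zeroˡ x)

Bsum-linear : ∀ n q a b (g h : ℕ → ℚ) →
  Bsum n q (λ d → a * g d + b * h d) ≡ a * Bsum n q g + b * Bsum n q h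
Bsum-linear n q a b g h = begin
  ∑ (SB n) (λ σ → (a * g (desB σ) + b * h (desB σ)) * q ^ neg σ)
    ≡⟨ ∑-cong (SB n) (λ {σ} _ → distrib a b (g (desB σ)) (h (desB σ)) (q ^ neg σ)) ⟩
  ∑ (SB n) (λ σ → a * (g (desB σ) * q ^ neg σ) + b * (h (desB σ) * q ^ neg σ))
    ≡⟨ ∑-+ (SB n) (λ σ → a * (g (desB σ) * q ^ neg σ)) (λ σ → b * (h (desB σ) * q ^ neg σ)) ⟩
  ∑ (SB n) (λ σ → a * (g (desB σ) * q ^ neg σ)) + ∑ (SB n) (λ σ → b * (h (desB σ) * q ^ neg σ))
    ≡⟨ cong₂ _+_ (∑-*ˡ (SB n) a _) (∑-*ˡ (SB n) b _) ⟩
  a * Bsum n q g + b * Bsum n q h ∎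
  where
  open ≡-Reasoning
  distrib : ∀ a b x y Q → (a * x + b * y) * Q ≡ a * (x * Q) + b * (y * Q)
  distrib = solve-∀ ℚ-ring

shift : (ℕ → ℚ) → ℕ → ℚ
shift b zero    = 0ℚ
shift b (suc k) = b k

Bsum-δ∘suc : ∀ n q i → Bsum n q (δ i ∘ suc) ≡ shift (Bcoef n q) i
Bsum-δ∘suc n q zero    = trans (∑-*ˡ (SB n) 0ℚ (λ σ → q ^ neg σ)) (ℚP.*-zeroˡ (∑ (SB n) (λ σ → q ^ neg σ)))
Bsum-δ∘suc n q (suc k) = sym (Bcoef≡Bsum n q k)

Bcoef-recurrence : ∀ {n i j} q → i ℕ.+ j ≡ suc n →
  Bcoef (suc n) q i ≡ keep q i * Bcoef n q i + rise q j * shift (Bcoef n q) i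
Bcoef-recurrence {n} {i} {j} q i+j≡1+n = begin
  Bcoef (suc n) q i
    ≡⟨ Bcoef≡Bsum (suc n) q i ⟩
  Bsum (suc n) q (δ i)
    ≡⟨ Bsum-suc n q (δ i) ⟩
  Bsum n q (λ d → keep q d * δ i d + rise q (n ∸ d) * δ i (suc d))
    ≡⟨ ∑-cong (SB n) (λ {σ} _ → cong (_* q ^ neg σ)
         (cong₂ _+_ (δ-absorb (keep q) i (desB σ)) (rise-absorb i i+j≡1+n (desB σ)))) ⟩
  Bsum n q (λ d → keep q i * δ i d + rise q j * δ i (suc d))
    ≡⟨ Bsum-linear n q (keep q i) (rise q j) (δ i) (δ i ∘ suc) ⟩
  keep q i * Bsum n q (δ i) + rise q j * Bsum n q (δ i ∘ suc)
    ≡⟨ cong₂ (λ s t → keep q i * s + rise q j * t) (sym (Bcoef≡Bsum n q i)) (Bsum-δ∘suc n q i) ⟩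
  keep q i * Bcoef n q i + rise q j * shift (Bcoef n q) i ∎
  where
  open ≡-Reasoning
  rise-absorb : ∀ i → i ℕ.+ j ≡ suc n → ∀ d → rise q (n ∸ d) * δ i (suc d) ≡ rise q j * δ i (suc d)
  rise-absorb zero    _      d = trans (ℚP.*-zeroʳ (rise q (n ∸ d))) (sym (ℚP.*-zeroʳ (rise q j)))
  rise-absorb (suc k) k+j≡n d = trans (δ-absorb (λ d → rise q (n ∸ d)) k d)
    (cong (λ m → rise q m * δ k d) (trans (cong (_∸ k) (sym (ℕP.suc-injective k+j≡n))) (ℕP.m+n∸m≡n k j)))

Bcoef-nonneg : ∀ n {q} → 0ℚ ≤ q → ∀ k → 0ℚ ≤ Bcoef n q k
Bcoef-nonneg n 0≤q k = ∑-nonneg (filter (λ σ → desB σ ℕ.≟ k) (SB n)) (λ σ → ^-nonneg 0≤q (neg σ))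

Bcoef-vanishes : ∀ n q → Bcoef n q (suc n) ≡ 0ℚ
Bcoef-vanishes n q = cong (λ σs → ∑ σs (λ σ → q ^ neg σ))
  (ListP.filter-none (λ σ → desB σ ℕ.≟ suc n) (All.tabulate (λ {σ} σ∈ → desB≢1+n σ∈)))
  where
  desB≢1+n : ∀ {σ} → σ ∈ SB n → desB σ ≢ suc n
  desB≢1+n {σ} σ∈ = ℕP.<⇒≢ (s≤s (subst (desB σ ℕ.≤_) (proj₁ (∈-SB⁻ {n} σ∈)) (descents≤length (+ 0) σ)))

-- Alternatingly increasing and spiral coefficients

-- The chains of AlternatinglyIncreasing and Spiral, indexed by pairs i + j = n.  Allowing i = j adds
-- only trivial conditions and spares side conditions whenever the induction hypothesis is applied.
AlternatinglyIncreasingPairs : ℕ → (ℕ → ℚ) → Set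
AlternatinglyIncreasingPairs n b =
  (∀ {i j} → i ℕ.+ j ≡ n → i ℕ.≤ j → b i ≤ b j) ×
  (∀ {i j} → i ℕ.+ j ≡ n → suc i ℕ.≤ j → b j ≤ b (suc i))

SpiralPairs : ℕ → (ℕ → ℚ) → Set
SpiralPairs n b =
  (∀ {i j} → i ℕ.+ j ≡ n → i ℕ.≤ j → b j ≤ b i) ×
  (∀ {i j} → suc (i ℕ.+ j) ≡ n → i ℕ.≤ j → b i ≤ b j)

keep-nonneg : ∀ {q} → 0ℚ ≤ q → ∀ k → 0ℚ ≤ keep q k
keep-nonneg 0≤q k = +-nonneg (·1-nonneg (suc k)) (*-nonneg 0≤q (·1-nonneg k))

rise-nonneg : ∀ {q} → 0ℚ ≤ q → ∀ k → 0ℚ ≤ rise q k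
rise-nonneg 0≤q k = +-nonneg (·1-nonneg k) (*-nonneg 0≤q (·1-nonneg (suc k)))

+-suc-injective : ∀ {i j n} → i ℕ.+ suc j ≡ suc n → i ℕ.+ j ≡ n
+-suc-injective {i} {j} e = ℕP.suc-injective (trans (sym (ℕP.+-suc i j)) e)

≤-cases : ∀ {i j} {P : Set} → i ℕ.≤ j → (i ≡ j → P) → (i ℕ.< j → P) → P
≤-cases i≤j equal strict = [ strict , equal ]′ (ℕP.m≤n⇒m<n∨m≡n i≤j)

module _ {n : ℕ} {q : ℚ} {b c : ℕ → ℚ} (0≤q : 0ℚ ≤ q) (b≥0 : ∀ k → 0ℚ ≤ b k)
         (b-vanishes : b (suc n) ≡ 0ℚ)
         (recurrence : ∀ {i j} → i ℕ.+ j ≡ suc n → c i ≡ keep q i * b i + rise q j * shift b i) where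

  private
    recurrenceᶜ : ∀ {i j} → i ℕ.+ j ≡ suc n → c j ≡ keep q j * b j + rise q i * shift b j
    recurrenceᶜ {i} {j} e = recurrence (trans (ℕP.+-comm j i) e)

  alternatinglyIncreasing-step : 1ℚ ≤ q → AlternatinglyIncreasingPairs n b →
                                 AlternatinglyIncreasingPairs (suc n) c
  alternatinglyIncreasing-step 1≤q (ai₁ , ai₂) = rising , falling
    where
    shift-rising : ∀ {i j} → i ℕ.+ j ≡ suc n → i ℕ.≤ j → shift b i ≤ b j
    shift-rising {zero}  _ _   = b≥0 _
    shift-rising {suc i} e i<j = ai₁ (ℕP.suc-injective e) (ℕP.<⇒≤ i<j)

    shift-falling : ∀ {i j} → i ℕ.+ j ≡ suc n → i ℕ.≤ j → b j ≤ b i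
    shift-falling {zero}  refl _   = subst (_≤ b 0) (sym b-vanishes) (b≥0 0)
    shift-falling {suc i} e    i≤j = ai₂ (ℕP.suc-injective e) i≤j

    rising : ∀ {i j} → i ℕ.+ j ≡ suc n → i ℕ.≤ j → c i ≤ c j
    rising e i≤j = ≤-cases i≤j (λ { refl → ℚP.≤-refl }) (strict e)
      where
      strict : ∀ {i j} → i ℕ.+ j ≡ suc n → i ℕ.< j → c i ≤ c j
      strict {i} {suc j} e (s≤s i≤j) =
        ≤-by-difference (keep q (suc j)) (rise q i) (q - 1ℚ)
          (keep-nonneg 0≤q (suc j)) (rise-nonneg 0≤q i) (p≤q⇒0≤q-p 1≤q)
          (shift-rising e (ℕP.m≤n⇒m≤1+n i≤j)) (ai₁ (+-suc-injective e) i≤j)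
          (ℚP.≤-trans (shift-rising e (ℕP.m≤n⇒m≤1+n i≤j)) (shift-falling e (ℕP.m≤n⇒m≤1+n i≤j)))
          (trans (cong₂ _-_ (recurrenceᶜ e) (recurrence e))
                 (rising-identity q (i · 1ℚ) (suc j · 1ℚ) (b i) (b (suc j)) (shift b i) (b j)))
        where
        rising-identity : ∀ q I J bi bj pi pj →
          (((1ℚ + J) + q * J) * bj + (I + q * (1ℚ + I)) * pj) -
          (((1ℚ + I) + q * I) * bi + (J + q * (1ℚ + J)) * pi) ≡
          ((1ℚ + J) + q * J) * (bj - pi) + (I + q * (1ℚ + I)) * (pj - bi) + (q - 1ℚ) * (bi - pi)
        rising-identity = solve-∀ ℚ-ring

    falling : ∀ {i j} → i ℕ.+ j ≡ suc n → suc i ℕ.≤ j → c j ≤ c (suc i)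
    falling e 1+i≤j = ≤-cases 1+i≤j (λ { refl → ℚP.≤-refl }) (strict e)
      where
      strict : ∀ {i j} → i ℕ.+ j ≡ suc n → suc i ℕ.< j → c j ≤ c (suc i)
      strict {i} {suc j} e (s≤s 1+i≤j) =
        ≤-by-difference (rise q i) (rise q j) (1ℚ + 1ℚ)
          (rise-nonneg 0≤q i) (rise-nonneg 0≤q j) (+-nonneg 0≤1 0≤1)
          (ai₂ e′ 1+i≤j) bj≤bi
          (ℚP.≤-trans bj≤bi (ℚP.≤-trans (ai₁ e′ (ℕP.<⇒≤ 1+i≤j)) (ai₂ e′ 1+i≤j)))
          (trans (cong₂ _-_ (recurrence (trans (sym (ℕP.+-suc i j)) e)) (recurrenceᶜ e))
                 (falling-identity q (i · 1ℚ) (j · 1ℚ) (b (suc i)) (b i) (b (suc j)) (b j)))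
        where
        e′ : i ℕ.+ j ≡ n
        e′ = +-suc-injective e
        bj≤bi : b (suc j) ≤ b i
        bj≤bi = shift-falling e (ℕP.m≤n⇒m≤1+n (ℕP.<⇒≤ 1+i≤j))
        falling-identity : ∀ q I J bsi bi bsj bj →
          (((1ℚ + (1ℚ + I)) + q * (1ℚ + I)) * bsi + (J + q * (1ℚ + J)) * bi) -
          (((1ℚ + (1ℚ + J)) + q * (1ℚ + J)) * bsj + (I + q * (1ℚ + I)) * bj) ≡
          (I + q * (1ℚ + I)) * (bsi - bj) + (J + q * (1ℚ + J)) * (bi - bsj) + (1ℚ + 1ℚ) * (bsi - bsj)
        falling-identity = solve-∀ ℚ-ring

  spiral-step : q ≤ 1ℚ → SpiralPairs n b → SpiralPairs (suc n) c
  spiral-step q≤1 (sp₁ , sp₂) = falling , rising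
    where
    shift-above : ∀ {i j} → i ℕ.+ j ≡ suc n → i ℕ.≤ j → b j ≤ shift b i
    shift-above {zero}  refl _   = ℚP.≤-reflexive b-vanishes
    shift-above {suc i} e    i<j = sp₁ (ℕP.suc-injective e) (ℕP.<⇒≤ i<j)

    shift-below : ∀ {i j} → i ℕ.+ j ≡ n → i ℕ.≤ j → shift b i ≤ b j
    shift-below {zero}  _ _   = b≥0 _
    shift-below {suc i} e i<j = sp₂ e (ℕP.<⇒≤ i<j)

    falling : ∀ {i j} → i ℕ.+ j ≡ suc n → i ℕ.≤ j → c j ≤ c i
    falling e i≤j = ≤-cases i≤j (λ { refl → ℚP.≤-refl }) (strict e)
      where
      strict : ∀ {i j} → i ℕ.+ j ≡ suc n → i ℕ.< j → c j ≤ c i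
      strict {i} {suc j} e (s≤s i≤j) =
        ≤-by-difference (keep q (suc j)) (rise q i) (1ℚ - q)
          (keep-nonneg 0≤q (suc j)) (rise-nonneg 0≤q i) (p≤q⇒0≤q-p q≤1)
          (shift-above e (ℕP.m≤n⇒m≤1+n i≤j)) bj≤bi
          (ℚP.≤-trans (shift-below e′ i≤j) bj≤bi)
          (trans (cong₂ _-_ (recurrence e) (recurrenceᶜ e))
                 (falling-identity q (i · 1ℚ) (suc j · 1ℚ) (b i) (b (suc j)) (shift b i) (b j)))
        where
        e′ : i ℕ.+ j ≡ n
        e′ = +-suc-injective e
        bj≤bi : b j ≤ b i
        bj≤bi = sp₁ e′ i≤j
        falling-identity : ∀ q I J bi bj pi pj →
          (((1ℚ + I) + q * I) * bi + (J + q * (1ℚ + J)) * pi) -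
          (((1ℚ + J) + q * J) * bj + (I + q * (1ℚ + I)) * pj) ≡
          ((1ℚ + J) + q * J) * (pi - bj) + (I + q * (1ℚ + I)) * (bi - pj) + (1ℚ - q) * (bi - pi)
        falling-identity = solve-∀ ℚ-ring

    rising : ∀ {i j} → suc (i ℕ.+ j) ≡ suc n → i ℕ.≤ j → c i ≤ c j
    rising e i≤j = ≤-cases i≤j (λ { refl → ℚP.≤-refl }) (strict (ℕP.suc-injective e))
      where
      strict : ∀ {i j} → i ℕ.+ j ≡ n → i ℕ.< j → c i ≤ c j
      strict {i} {suc j} e (s≤s i≤j) =
        ≤-by-difference (keep q (suc j)) (keep q i) (q + q)
          (keep-nonneg 0≤q (suc j)) (keep-nonneg 0≤q i) (+-nonneg 0≤q 0≤q)
          bi′≤bj (sp₂ (trans (sym (ℕP.+-suc i j)) e) i≤j)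
          (ℚP.≤-trans bi′≤bj (ℚP.≤-trans (sp₁ e (ℕP.m≤n⇒m≤1+n i≤j)) (sp₂ (trans (sym (ℕP.+-suc i j)) e) i≤j)))
          (trans (cong₂ _-_ (recurrence e₋) (recurrence e₊))
                 (rising-identity q (i · 1ℚ) (suc j · 1ℚ) (b i) (b (suc j)) (shift b i) (b j)))
        where
        e₊ : i ℕ.+ suc (suc j) ≡ suc n
        e₊ = trans (ℕP.+-suc i (suc j)) (cong suc e)
        e₋ : suc j ℕ.+ suc i ≡ suc n
        e₋ = cong suc (trans (ℕP.+-suc j i) (trans (ℕP.+-comm (suc j) i) e))
        bi′≤bj : shift b i ≤ b (suc j)
        bi′≤bj = shift-below e (ℕP.m≤n⇒m≤1+n i≤j)
        rising-identity : ∀ q I J bi bj pi pj →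
          (((1ℚ + J) + q * J) * bj + ((1ℚ + I) + q * (1ℚ + (1ℚ + I))) * pj) -
          (((1ℚ + I) + q * I) * bi + ((1ℚ + J) + q * (1ℚ + (1ℚ + J))) * pi) ≡
          ((1ℚ + J) + q * J) * (bj - pi) + ((1ℚ + I) + q * I) * (pj - bi) + (q + q) * (pj - pi)
        rising-identity = solve-∀ ℚ-ring

Bcoef-alternatinglyIncreasing : ∀ n {q} → 1ℚ ≤ q → AlternatinglyIncreasingPairs n (Bcoef n q)
Bcoef-alternatinglyIncreasing zero    {q} _   = rising , falling
  where
  rising : ∀ {i j} → i ℕ.+ j ≡ 0 → i ℕ.≤ j → Bcoef 0 q i ≤ Bcoef 0 q j
  rising {zero} {zero} _ _ = ℚP.≤-refl
  falling : ∀ {i j} → i ℕ.+ j ≡ 0 → suc i ℕ.≤ j → Bcoef 0 q j ≤ Bcoef 0 q (suc i)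
  falling {zero} {zero} _ ()
Bcoef-alternatinglyIncreasing (suc n) {q} 1≤q =
  alternatinglyIncreasing-step 0≤q (Bcoef-nonneg n 0≤q) (Bcoef-vanishes n q) (Bcoef-recurrence q)
    1≤q (Bcoef-alternatinglyIncreasing n 1≤q)
  where
  0≤q : 0ℚ ≤ q
  0≤q = ℚP.≤-trans 0≤1 1≤q

Bcoef-spiral : ∀ n {q} → 0ℚ ≤ q → q ≤ 1ℚ → SpiralPairs n (Bcoef n q)
Bcoef-spiral zero    {q} _   _   = falling , (λ ())
  where
  falling : ∀ {i j} → i ℕ.+ j ≡ 0 → i ℕ.≤ j → Bcoef 0 q j ≤ Bcoef 0 q i
  falling {zero} {zero} _ _ = ℚP.≤-refl
Bcoef-spiral (suc n) {q} 0≤q q≤1 =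
  spiral-step 0≤q (Bcoef-nonneg n 0≤q) (Bcoef-vanishes n q) (Bcoef-recurrence q)
    q≤1 (Bcoef-spiral n 0≤q q≤1)

mirror-index : ∀ {m l n} → m ℕ.+ l ℕ.≤ n → l ℕ.+ (n ∸ l) ≡ n × m ℕ.≤ n ∸ l
mirror-index {m} m+l≤n = ℕP.m+[n∸m]≡n (ℕP.m+n≤o⇒n≤o m m+l≤n) , ℕP.m+n≤o⇒m≤o∸n m m+l≤n

2i+1≡1+i+i : ∀ i → 2 ℕ.* i ℕ.+ 1 ≡ suc i ℕ.+ i
2i+1≡1+i+i = ℕ-Solver.solve-∀

2i+2≡2+i+i : ∀ i → 2 ℕ.* i ℕ.+ 2 ≡ suc (suc i) ℕ.+ i
2i+2≡2+i+i = ℕ-Solver.solve-∀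

2i+2≡1+i+1+i : ∀ i → 2 ℕ.* i ℕ.+ 2 ≡ suc i ℕ.+ suc i
2i+2≡1+i+1+i = ℕ-Solver.solve-∀

pairs⇒alternatinglyIncreasing : ∀ {n b} → AlternatinglyIncreasingPairs n b → AlternatinglyIncreasing n b
pairs⇒alternatinglyIncreasing {n} (rising , falling) i =
  (λ 2i+1≤n → let e , 1+i≤n∸i = mirror-index (subst (ℕ._≤ n) (2i+1≡1+i+i i) 2i+1≤n)
              in rising e (ℕP.<⇒≤ 1+i≤n∸i)) ,
  (λ 2i+2≤n → let e , 2+i≤n∸i = mirror-index (subst (ℕ._≤ n) (2i+2≡2+i+i i) 2i+2≤n)
              in falling e (ℕP.<⇒≤ 2+i≤n∸i))

pairs⇒spiral : ∀ {n b} → SpiralPairs n b → Spiral n b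
pairs⇒spiral {n} (falling , rising) i =
  (λ 2i+1≤n → let e , 1+i≤n∸i = mirror-index (subst (ℕ._≤ n) (2i+1≡1+i+i i) 2i+1≤n)
              in falling e (ℕP.<⇒≤ 1+i≤n∸i)) ,
  (λ 2i+2≤n → let e , 1+i≤n∸1+i = mirror-index (subst (ℕ._≤ n) (2i+2≡1+i+1+i i) 2i+2≤n)
              in rising e (ℕP.<⇒≤ 1+i≤n∸1+i))

corollary42 : (n : ℕ) → n ≥ 1 → (q : ℚ) →
              (1ℚ ≤ q → AlternatinglyIncreasing n (Bcoef n q))
            × (0ℚ ≤ q → q ≤ 1ℚ → Spiral n (Bcoef n q))
corollary42 n _ q =
  (λ 1≤q → pairs⇒alternatinglyIncreasing (Bcoef-alternatinglyIncreasing n 1≤q)) ,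
  (λ 0≤q q≤1 → pairs⇒spiral (Bcoef-spiral n 0≤q q≤1))
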